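{- Let $\Gamma$ be a distance-regular graph with diameter $D\ge3$ and $a_1\ne0$. Let $\sigma_0,\dots,\sigma_D$ and $\rho_0,\dots,\rho_D$ be nontrivial pseudo cosine sequences forming a tight pair, and let $\varepsilon$ be a real number with $\sigma_i\rho_i-\sigma_{i-1}\rho_{i-1}=\varepsilon(\sigma_{i-1}\rho_i-\sigma_i\rho_{i-1})$ for $1\le i\le D$. Then for each $i$ with $1\le i\le D-1$ the following are equivalent: (i) $\sigma_{i-1}=\varepsilon\sigma_i$; (ii) $\sigma_{i+1}=\varepsilon\sigma_i$; (iii) $\sigma_{i-1}=\sigma_{i+1}$; (iv) $\rho_i=0$.
   Context: $\Gamma$ is a finite, undirected, connected graph without loops or multiple edges, with path-length distance $\partial$ and diameter $D$. It is distance-regular: for all $0\le h,i,j\le D$ and all vertices $x,y$ with $\partial(x,y)=h$, the number $p^h_{ij}$ of vertices $z$ with $\partial(x,z)=i$, $\partial(y,z)=j$ depends only on $h,i,j$. Write $a_i=p^i_{1i}$, $b_i=p^i_{1,i+1}$ $(0\le i\le D-1)$, $c_i=p^i_{1,i-1}$ $(1\le i\le D)$, $c_0=0$, $b_D=0$, $k=b_0$. A pseudo cosine sequence (for $\theta\in\mathbb{R}$) is a sequence of reals $\sigma_0,\dots,\sigma_D$ with $\sigma_0=1$ and $c_i\sigma_{i-1}+a_i\sigma_i+b_i\sigma_{i+1}=\theta\sigma_i$ for $0\le i\le D-1$ (with $c_0\sigma_{ -1}=0$). It is trivial if it is the one for $\theta=k$ (all entries $1$), nontrivial otherwise. Two pseudo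 cosine sequences $\sigma_i,\rho_i$ form a tight pair if $\sigma_0\rho_0,\dots,\sigma_D\rho_D$ is a pseudo cosine sequence. -}

module Defs where

open import Level using (Level; _⊔_) renaming (suc to lsuc)
open import Data.Nat using (ℕ; zero; suc; _≤_; _<_; _∸_)
open import Data.Bool using (Bool; true; false; _∧_; _∨_; not)
open import Data.Fin using (Fin)
open import Data.Fin.Properties using () renaming (_≟_ to _≟ᶠ_)
open import Data.List using (List; length; filter)
open import Data.Bool.ListAction using (any)
open import Data.List using (allFin)
open import Data.Product using (Σ; ∃; _×_; _,_)
open import Relation.Nullary using (¬_; does)
open import Relation.Nullary.Decidable using (⌊_⌋)
open import Relation.Binary.PropositionalEquality using (_≡_)
open import Relation.Binary.Structures using (IsStrictTotalOrder)
open import Algebra.Bundles using (CommutativeRing)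
open import Function.Bundles using (_⇔_)

-- Ordered fields (the real numbers are an instance; the stdlib has no ℝ).

record OrderedField (c ℓ : Level) : Set (lsuc (c ⊔ ℓ)) where
  field
    commutativeRing : CommutativeRing c ℓ
  open CommutativeRing commutativeRing public
  field
    _<ᶠ_                : Carrier → Carrier → Set ℓ
    isStrictTotalOrder : IsStrictTotalOrder _≈_ _<ᶠ_
    0<1                : 0# <ᶠ 1#
    +-mono-<           : ∀ {x y} z → x <ᶠ y → (x + z) <ᶠ (y + z)
    *-pos              : ∀ {x y} → 0# <ᶠ x → 0# <ᶠ y → 0# <ᶠ (x * y)
    inverse            : ∀ x → ¬ (x ≈ 0#) → ∃ λ y → (x * y) ≈ 1#

  infixl 6 _−_
  _−_ : Carrier → Carrier → Carrier
  x − y = x + (- y)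

  fromℕ : ℕ → Carrier
  fromℕ zero    = 0#
  fromℕ (suc n) = 1# + fromℕ n

record Graph : Set where
  field
    n     : ℕ
    adj   : Fin n → Fin n → Bool
    sym   : ∀ x y → adj x y ≡ adj y x
    irrefl : ∀ x → adj x x ≡ false

module _ (G : Graph) where
  open Graph G

  reach : ℕ → Fin n → Fin n → Bool
  reach zero    x y = ⌊ x ≟ᶠ y ⌋
  reach (suc l) x y = reach l x y ∨ any (λ z → reach l x z ∧ adj z y) (allFin n)

  isDist : Fin n → Fin n → ℕ → Bool
  isDist x y zero    = reach zero x y
  isDist x y (suc i) = reach (suc i) x y ∧ not (reach i x y)

  countP : Fin n → Fin n → ℕ → ℕ → ℕ
  countP x y i j = length (filter (λ z → (isDist x z i ∧ isDist y z j) ≡? true) (allFin n))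
    where
      open import Data.Bool.Properties using () renaming (_≟_ to _≡?_)

  HasDiameter : ℕ → Set
  HasDiameter D = (∀ x y → reach D x y ≡ true)
                × Σ (Fin n) λ x → Σ (Fin n) λ y → isDist x y D ≡ true

  IsDistanceRegular : ℕ → (ℕ → ℕ → ℕ → ℕ) → Set
  IsDistanceRegular D p =
    HasDiameter D ×
    (∀ h i j → h ≤ D → i ≤ D → j ≤ D → ∀ x y → isDist x y h ≡ true →
       countP x y i j ≡ p h i j)

module Intersection (p : ℕ → ℕ → ℕ → ℕ) where
  aᵢ : ℕ → ℕ
  aᵢ i = p i 1 i
  bᵢ : ℕ → ℕ
  bᵢ i = p i 1 (suc i)
  cᵢ : ℕ → ℕ
  cᵢ i = p i 1 (i ∸ 1)
  k : ℕ
  k = bᵢ 0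

module PseudoCosine {c ℓ} (F : OrderedField c ℓ) (D : ℕ) (p : ℕ → ℕ → ℕ → ℕ) where
  open OrderedField F
  open Intersection p

  -- left-hand side  c_i σ_{i-1} + a_i σ_i + b_i σ_{i+1}  (with c_0 σ_{-1} = 0)
  recLHS : (ℕ → Carrier) → ℕ → Carrier
  recLHS σ zero    = fromℕ (aᵢ 0) * σ 0 + fromℕ (bᵢ 0) * σ 1
  recLHS σ (suc i) = fromℕ (cᵢ (suc i)) * σ i + fromℕ (aᵢ (suc i)) * σ (suc i)
                     + fromℕ (bᵢ (suc i)) * σ (suc (suc i))

  IsPCSFor : (ℕ → Carrier) → Carrier → Set ℓ
  IsPCSFor σ θ = (σ 0 ≈ 1#) × (∀ i → suc i ≤ D → recLHS σ i ≈ θ * σ i)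

  IsPCS : (ℕ → Carrier) → Set (c ⊔ ℓ)
  IsPCS σ = ∃ λ θ → IsPCSFor σ θ

  Nontrivial : (ℕ → Carrier) → Set ℓ
  Nontrivial σ = ¬ IsPCSFor σ (fromℕ k)

  TightPair : (ℕ → Carrier) → (ℕ → Carrier) → Set (c ⊔ ℓ)
  TightPair σ ρ = IsPCS (λ i → σ i * ρ i)

module Submission where

-- Write x, y, z for σ (i − 1), σ i, σ (i + 1) and r, s, t for the corresponding ρ's.  The
-- relations at i − 1 and i, rearranged, read s (y − ε x) = r (x − ε y) and t (z − ε y) = s (y − ε z).
-- A pseudo cosine sequence has no two consecutive zeros, and ε² ≠ 1 (for ε = ±1 the relations
-- factor, and following them through i = 0, 1, 2 contradicts a₁, a₂, c₁ ≥ 1; this uses D ≥ 3),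
-- so these two equations alone give (i) ⇔ (iv) ⇔ (ii), hence (ii) ⇒ (iii).  For (iii) ⇒ (iv):
-- if x = z but s ≠ 0 and x ≠ ε y, then t = r, both three-term recurrences at i become symmetric,
-- and eliminating x and r yields a quadratic relation in θ, θ′.  Together with
-- θ θ′ − k² = ε k (θ′ − θ), the relation at 0, it forces aᵢ (k − θ) (k − θ′) = 0, which is
-- impossible since aᵢ ≥ 1 (as a₁ ≠ 0) and both sequences are nontrivial.

open import Defs
open import Algebra.Bundles using (CommutativeRing)
open import Algebra.Solver.Ring.AlmostCommutativeRing
  using (_-Raw-AlmostCommutative⟶_; fromCommutativeRing; Induced-equivalence)
open import Data.Bool using (Bool; true; false; T; _∧_; not)
open import Data.Bool.Properties using (T-∧; T-∨; T-≡; T-not-≡) renaming (_≟_ to _≟ᵇ_)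
open import Data.Empty using (⊥; ⊥-elim)
open import Data.Fin using (Fin)
open import Data.Integer as ℤ using (ℤ; -[1+_]; _◃_; sign; ∣_∣)
import Data.Integer.Properties as ℤ
open import Data.List using (List; []; _∷_; length; filter; allFin)
open import Data.List.Membership.Propositional using (_∈_; lose)
open import Data.List.Membership.Propositional.Properties using (∈-allFin; ∈-filter⁺)
open import Data.List.Relation.Unary.Any using (satisfied)
open import Data.List.Relation.Unary.Any.Properties using (any⁺; any⁻)
open import Data.Maybe using (just; nothing)
open import Data.Nat as ℕ
  using (ℕ; zero; suc; _≤_; _<_; z≤n; s≤s; _≤′_; ≤′-refl; ≤′-step; _∸_)
open import Data.Nat.Properties
  using (≤-refl; ≤-trans; ≤-antisym; ≤-pred; ≰⇒>; _≤?_; ≤⇒≤′; n≤1+n; n<1+n; m≤n⇒m≤1+n;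
         m<n⇒m<1+n; m≤n⇒m<n∨m≡n; <⇒≢; >⇒≢; +-suc; m≤m+n; m≤n+m; +-mono-≤; *-mono-≤;
         *-monoʳ-≤; *-distribʳ-+; module ≤-Reasoning)
open import Data.Product using (∃-syntax; ∃₂; _×_; _,_; proj₁; proj₂)
open import Data.Sign as Sign using (Sign)
open import Data.Sum using (_⊎_; inj₁; inj₂; [_,_])
open import Function using (_∘_; _$_; case_of_)
open import Function.Bundles using (Equivalence; _⇔_; mk⇔)
open import Relation.Nullary using (¬_; yes; no)
open import Relation.Nullary.Decidable using (toWitness; fromWitness; T?)
open import Relation.Binary.Definitions using (Decidable; WeaklyDecidable)
open import Relation.Binary.Structures using (IsStrictTotalOrder)
open import Relation.Binary.PropositionalEquality as ≡ using (_≡_; _≢_)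

open Equivalence using (to; from)

module IntegerCoefficientSolver {c ℓ} (R : CommutativeRing c ℓ) where
  open CommutativeRing R
  open import Algebra.Properties.Ring ring
    using (-0#≈0#; -‿anti-homo-+; -‿+-comm; -‿distribˡ-*; -‿distribʳ-*; -‿involutive)
  open import Algebra.Properties.Semiring.Mult.TCOptimised semiring
    using (1+×; ×-homo-+; ×1-homo-*) renaming (_×_ to _×ₙ_)
  open import Relation.Binary.Reasoning.Setoid setoid

  -- With the type-checking-optimised multiple, fromℤ (+ 1) reduces to 1#, so the solver
  -- constant :1 below denotes 1# on the nose.
  fromℤ : ℤ → Carrier
  fromℤ (ℤ.+ n)    = n ×ₙ 1#
  fromℤ (-[1+ n ]) = - (suc n ×ₙ 1#)

  fromℤ-⊖ : ∀ m n → fromℤ (m ℤ.⊖ n) ≈ m ×ₙ 1# - n ×ₙ 1#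
  fromℤ-⊖ m       zero    = sym (trans (+-congˡ -0#≈0#) (+-identityʳ _))
  fromℤ-⊖ zero    (suc n) = sym (+-identityˡ _)
  fromℤ-⊖ (suc m) (suc n) = begin
    fromℤ (suc m ℤ.⊖ suc n)            ≡⟨ ≡.cong fromℤ (ℤ.[1+m]⊖[1+n]≡m⊖n m n) ⟩
    fromℤ (m ℤ.⊖ n)                    ≈⟨ fromℤ-⊖ m n ⟩
    m ×ₙ 1# - n ×ₙ 1#                  ≈⟨ +-congˡ (+-identityˡ _) ⟨
    m ×ₙ 1# + (0# - n ×ₙ 1#)           ≈⟨ +-congˡ (+-congʳ (-‿inverseʳ 1#)) ⟨
    m ×ₙ 1# + ((1# - 1#) - n ×ₙ 1#)    ≈⟨ +-congˡ (+-assoc 1# (- 1#) _) ⟩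
    m ×ₙ 1# + (1# + (- 1# - n ×ₙ 1#))  ≈⟨ +-assoc _ 1# _ ⟨
    (m ×ₙ 1# + 1#) + (- 1# - n ×ₙ 1#)  ≈⟨ +-cong (+-comm 1# _) (-‿anti-homo-+ (n ×ₙ 1#) 1#) ⟨
    (1# + m ×ₙ 1#) - (n ×ₙ 1# + 1#)    ≈⟨ +-cong (1+× m 1#) (-‿cong (+-comm 1# _)) ⟨
    suc m ×ₙ 1# - (1# + n ×ₙ 1#)       ≈⟨ +-congˡ (-‿cong (1+× n 1#)) ⟨
    suc m ×ₙ 1# - suc n ×ₙ 1#          ∎

  fromℤ-+ : ∀ i j → fromℤ (i ℤ.+ j) ≈ fromℤ i + fromℤ j
  fromℤ-+ (ℤ.+ m)  (ℤ.+ n)  = ×-homo-+ 1# m n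
  fromℤ-+ (ℤ.+ m)  -[1+ n ] = fromℤ-⊖ m (suc n)
  fromℤ-+ -[1+ m ] (ℤ.+ n)  = trans (fromℤ-⊖ n (suc m)) (+-comm _ _)
  fromℤ-+ -[1+ m ] -[1+ n ] = begin
    - (suc (suc (m ℕ.+ n)) ×ₙ 1#)    ≡⟨ ≡.cong (λ l → - (suc l ×ₙ 1#)) (+-suc m n) ⟨
    - ((suc m ℕ.+ suc n) ×ₙ 1#)      ≈⟨ -‿cong (×-homo-+ 1# (suc m) (suc n)) ⟩
    - (suc m ×ₙ 1# + suc n ×ₙ 1#)    ≈⟨ -‿+-comm _ _ ⟨
    - (suc m ×ₙ 1#) - (suc n ×ₙ 1#)  ∎

  signed : Sign → Carrier → Carrier
  signed Sign.+ x = x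
  signed Sign.- x = - x

  signed-cong : ∀ s {x y} → x ≈ y → signed s x ≈ signed s y
  signed-cong Sign.+ x≈y = x≈y
  signed-cong Sign.- x≈y = -‿cong x≈y

  signed-* : ∀ s t x y → signed (s Sign.* t) (x * y) ≈ signed s x * signed t y
  signed-* Sign.+ Sign.+ x y = refl
  signed-* Sign.+ Sign.- x y = -‿distribʳ-* x y
  signed-* Sign.- Sign.+ x y = -‿distribˡ-* x y
  signed-* Sign.- Sign.- x y = sym (begin
    - x * - y    ≈⟨ -‿distribˡ-* x (- y) ⟨
    - (x * - y)  ≈⟨ -‿cong (-‿distribʳ-* x y) ⟨
    - - (x * y)  ≈⟨ -‿involutive (x * y) ⟩
    x * y        ∎)

  fromℤ-◃ : ∀ s n → fromℤ (s ◃ n) ≈ signed s (n ×ₙ 1#)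
  fromℤ-◃ Sign.+ zero    = refl
  fromℤ-◃ Sign.- zero    = sym -0#≈0#
  fromℤ-◃ Sign.+ (suc n) = refl
  fromℤ-◃ Sign.- (suc n) = refl

  fromℤ-* : ∀ i j → fromℤ (i ℤ.* j) ≈ fromℤ i * fromℤ j
  fromℤ-* i j = begin
    fromℤ (s ◃ (∣ i ∣ ℕ.* ∣ j ∣))                                ≈⟨ fromℤ-◃ s (∣ i ∣ ℕ.* ∣ j ∣) ⟩
    signed s ((∣ i ∣ ℕ.* ∣ j ∣) ×ₙ 1#)                           ≈⟨ signed-cong s (×1-homo-* ∣ i ∣ ∣ j ∣) ⟩
    signed s (∣ i ∣ ×ₙ 1# * ∣ j ∣ ×ₙ 1#)                          ≈⟨ signed-* (sign i) (sign j) _ _ ⟩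
    signed (sign i) (∣ i ∣ ×ₙ 1#) * signed (sign j) (∣ j ∣ ×ₙ 1#)  ≈⟨ *-cong (sign-abs i) (sign-abs j) ⟨
    fromℤ i * fromℤ j                                            ∎
    where
    s : Sign
    s = sign i Sign.* sign j
    sign-abs : ∀ i → fromℤ i ≈ signed (sign i) (∣ i ∣ ×ₙ 1#)
    sign-abs i = trans (reflexive (≡.cong fromℤ (≡.sym (ℤ.◃-inverse i)))) (fromℤ-◃ (sign i) ∣ i ∣)

  fromℤ-neg : ∀ i → fromℤ (ℤ.- i) ≈ - fromℤ i
  fromℤ-neg (ℤ.+ zero)  = sym -0#≈0#
  fromℤ-neg (ℤ.+ suc n) = refl
  fromℤ-neg -[1+ n ]    = sym (-‿involutive _)

  fromℤ-homomorphism :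
    CommutativeRing.rawRing ℤ.+-*-commutativeRing -Raw-AlmostCommutative⟶ fromCommutativeRing R
  fromℤ-homomorphism = record
    { ⟦_⟧ = fromℤ ; +-homo = fromℤ-+ ; *-homo = fromℤ-* ; -‿homo = fromℤ-neg
    ; 0-homo = refl ; 1-homo = refl
    }

  ≟-fromℤ : WeaklyDecidable (Induced-equivalence fromℤ-homomorphism)
  ≟-fromℤ i j with i ℤ.≟ j
  ... | yes ≡.refl = just refl
  ... | no  _      = nothing

  open import Algebra.Solver.Ring _ _ fromℤ-homomorphism ≟-fromℤ public
    using (Polynomial; solve; _:=_; _:+_; _:-_; _:*_; :-_; con)

  :1 : ∀ {n} → Polynomial n
  :1 = con (ℤ.+ 1)

module OrderedFieldProperties {c ℓ} (F : OrderedField c ℓ) where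
  open OrderedField F
  open import Algebra.Properties.Ring ring using (x≈y⇒x∙y⁻¹≈ε; x∙y⁻¹≈ε⇒x≈y; +-cancelˡ)
  open import Algebra.Properties.Semiring.Mult semiring using (×-homo-+; ×1-homo-*) renaming (_×_ to _×ₙ_)
  open import Relation.Binary.Reasoning.Setoid setoid
  private module < = IsStrictTotalOrder isStrictTotalOrder

  x≈y⇒x−y≈0 : ∀ {x y} → x ≈ y → x − y ≈ 0#
  x≈y⇒x−y≈0 = x≈y⇒x∙y⁻¹≈ε

  x−y≈0⇒x≈y : ∀ {x y} → x − y ≈ 0# → x ≈ y
  x−y≈0⇒x≈y = x∙y⁻¹≈ε⇒x≈y _ _

  infix 4 _≟_
  _≟_ : Decidable _≈_
  _≟_ = <._≟_

  x*y≈0⇒y≈0 : ∀ {x y} → ¬ x ≈ 0# → x * y ≈ 0# → y ≈ 0#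
  x*y≈0⇒y≈0 {x} {y} x≉0 xy≈0 with inverse x x≉0
  ... | x⁻¹ , xx⁻¹≈1 = begin
    y               ≈⟨ *-identityˡ y ⟨
    1# * y          ≈⟨ *-congʳ (trans (sym xx⁻¹≈1) (*-comm x x⁻¹)) ⟩
    (x⁻¹ * x) * y   ≈⟨ *-assoc x⁻¹ x y ⟩
    x⁻¹ * (x * y)   ≈⟨ *-congˡ xy≈0 ⟩
    x⁻¹ * 0#        ≈⟨ zeroʳ x⁻¹ ⟩
    0#              ∎

  x*y≈0⇒x≈0 : ∀ {x y} → ¬ y ≈ 0# → x * y ≈ 0# → x ≈ 0#
  x*y≈0⇒x≈0 y≉0 xy≈0 = x*y≈0⇒y≈0 y≉0 (trans (*-comm _ _) xy≈0)

  x*y≈0⇒x≈0⊎y≈0 : ∀ {x y} → x * y ≈ 0# → x ≈ 0# ⊎ y ≈ 0#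
  x*y≈0⇒x≈0⊎y≈0 {x} xy≈0 with x ≟ 0#
  ... | yes x≈0 = inj₁ x≈0
  ... | no  x≉0 = inj₂ (x*y≈0⇒y≈0 x≉0 xy≈0)

  x≉0∧y≉0⇒x*y≉0 : ∀ {x y} → ¬ x ≈ 0# → ¬ y ≈ 0# → ¬ x * y ≈ 0#
  x≉0∧y≉0⇒x*y≉0 x≉0 y≉0 xy≈0 = y≉0 (x*y≈0⇒y≈0 x≉0 xy≈0)

  -- Certificates for linear combinations of vanishing terms: most algebraic steps below
  -- write the goal, by a ring identity, as Σ cᵢ eᵢ with each eᵢ ≈ 0#.
  infixl 5 _⊕_
  infixr 6 _⊛_

  _⊕_ : ∀ {x y} → x ≈ 0# → y ≈ 0# → x + y ≈ 0#
  x≈0 ⊕ y≈0 = trans (+-cong x≈0 y≈0) (+-identityʳ 0#)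

  _⊛_ : ∀ a {x} → x ≈ 0# → a * x ≈ 0#
  a ⊛ x≈0 = trans (*-congˡ x≈0) (zeroʳ a)

  fromℕ≡×1 : ∀ n → fromℕ n ≡ n ×ₙ 1#
  fromℕ≡×1 zero    = ≡.refl
  fromℕ≡×1 (suc n) = ≡.cong (1# +_) (fromℕ≡×1 n)

  fromℕ-+ : ∀ m n → fromℕ (m ℕ.+ n) ≈ fromℕ m + fromℕ n
  fromℕ-+ m n rewrite fromℕ≡×1 m | fromℕ≡×1 n | fromℕ≡×1 (m ℕ.+ n) = ×-homo-+ 1# m n

  fromℕ-+₃ : ∀ l m n → fromℕ (l ℕ.+ m ℕ.+ n) ≈ fromℕ l + fromℕ m + fromℕ n
  fromℕ-+₃ l m n = trans (fromℕ-+ (l ℕ.+ m) n) (+-congʳ (fromℕ-+ l m))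

  fromℕ-* : ∀ m n → fromℕ (m ℕ.* n) ≈ fromℕ m * fromℕ n
  fromℕ-* m n rewrite fromℕ≡×1 m | fromℕ≡×1 n | fromℕ≡×1 (m ℕ.* n) = ×1-homo-* m n

  0<fromℕ-suc : ∀ n → 0# <ᶠ fromℕ (suc n)
  0<fromℕ-suc zero    = <.<-respʳ-≈ (sym (+-identityʳ 1#)) 0<1
  0<fromℕ-suc (suc n) = <.trans (<.<-respʳ-≈ (sym (+-identityˡ _)) (0<fromℕ-suc n))
                                (+-mono-< (fromℕ (suc n)) 0<1)

  1≉0 : ¬ 1# ≈ 0#
  1≉0 1≈0 = <.irrefl refl (<.<-respʳ-≈ 1≈0 0<1)

  fromℕ≉0 : ∀ {n} → 1 ≤ n → ¬ fromℕ n ≈ 0#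
  fromℕ≉0 {suc n} _ fromℕ≈0 = <.irrefl refl (<.<-respʳ-≈ fromℕ≈0 (0<fromℕ-suc n))

  fromℕ-injective : ∀ {m n} → fromℕ m ≈ fromℕ n → m ≡ n
  fromℕ-injective {zero}  {zero}  _ = ≡.refl
  fromℕ-injective {zero}  {suc n} e = ⊥-elim (fromℕ≉0 {suc n} (s≤s z≤n) (sym e))
  fromℕ-injective {suc m} {zero}  e = ⊥-elim (fromℕ≉0 {suc m} (s≤s z≤n) e)
  fromℕ-injective {suc m} {suc n} e = ≡.cong suc (fromℕ-injective (+-cancelˡ 1# _ _ e))

module TightPairAlgebra {f ℓ} (F : OrderedField f ℓ) where
  open OrderedField F
  open OrderedFieldProperties F
  open IntegerCoefficientSolver commutativeRing
  open import Relation.Binary.Reasoning.Setoid setoid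

  -- The relation σᵢ₊₁ ρᵢ₊₁ − σᵢ ρᵢ ≈ ε (σᵢ ρᵢ₊₁ − σᵢ₊₁ ρᵢ) with x, y, r, s = σᵢ, σᵢ₊₁, ρᵢ, ρᵢ₊₁,
  -- solved for the terms in ρ (balanced⇒cross).
  Cross : Carrier → Carrier → Carrier → Carrier → Carrier → Set ℓ
  Cross ε x y r s = s * (y − ε * x) ≈ r * (x − ε * y)

  cross-sym : ∀ {ε x y r s} → Cross ε x y r s → Cross ε y x s r
  cross-sym = sym

  balanced⇒cross : ∀ {ε x y r s} → y * s − x * r ≈ ε * (x * s − y * r) → Cross ε x y r s
  balanced⇒cross {ε} {x} {y} {r} {s} e = x−y≈0⇒x≈y (trans (identity ε x y r s) (x≈y⇒x−y≈0 e))
    where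
    identity : ∀ ε x y r s →
               s * (y − ε * x) − r * (x − ε * y) ≈ (y * s − x * r) − ε * (x * s − y * r)
    identity = solve 5 (λ ε x y r s → s :* (y :- ε :* x) :- r :* (x :- ε :* y)
                                   := (y :* s :- x :* r) :- ε :* (x :* s :- y :* r)) refl

  cross-zero : ∀ {ε x y r s} → Cross ε x y r s → s ≈ 0# → ¬ r ≈ 0# → x ≈ ε * y
  cross-zero {ε} {x} {y} {r} {s} c s≈0 r≉0 = x−y≈0⇒x≈y (x*y≈0⇒y≈0 r≉0 (begin
    r * (x − ε * y)   ≈⟨ c ⟨
    s * (y − ε * x)   ≈⟨ *-congʳ s≈0 ⟩
    0# * (y − ε * x)  ≈⟨ zeroˡ _ ⟩
    0#                ∎))

  cross-eigen : ∀ {ε x y r s} → Cross ε x y r s → x ≈ ε * y → ¬ y ≈ 0# → ¬ 1# − ε * ε ≈ 0# →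
                s ≈ 0#
  cross-eigen {ε} {x} {y} {r} {s} c x≈εy y≉0 ε²≉1 =
    x*y≈0⇒x≈0 (x≉0∧y≉0⇒x*y≉0 y≉0 ε²≉1) (begin
    s * (y * (1# − ε * ε))  ≈⟨ *-congˡ (identity ε y) ⟩
    s * (y − ε * (ε * y))   ≈⟨ *-congˡ (+-congˡ (-‿cong (*-congˡ x≈εy))) ⟨
    s * (y − ε * x)         ≈⟨ c ⟩
    r * (x − ε * y)         ≈⟨ *-congˡ (x≈y⇒x−y≈0 x≈εy) ⟩
    r * 0#                  ≈⟨ zeroʳ r ⟩
    0#                      ∎)
    where
    identity : ∀ ε y → y * (1# − ε * ε) ≈ y − ε * (ε * y)
    identity = solve 2 (λ ε y → y :* (:1 :- ε :* ε) := y :- ε :* (ε :* y)) refl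

  [1−x][1+x]≈1−x² : ∀ x → (1# − x) * (1# + x) ≈ 1# − x * x
  [1−x][1+x]≈1−x² = solve 1 (λ x → (:1 :- x) :* (:1 :+ x) := :1 :- x :* x) refl

  symmetric-recurrence : ∀ {a b c θ x y z} → c * x + a * y + b * z ≈ θ * y → z ≈ x →
                         (b + c) * x ≈ (θ − a) * y
  symmetric-recurrence {a} {b} {c} {θ} {x} {y} {z} rec z≈x =
    x−y≈0⇒x≈y (trans (identity a b c θ x y z) (x≈y⇒x−y≈0 rec ⊕ - b ⊛ x≈y⇒x−y≈0 z≈x))
    where
    identity : ∀ a b c θ x y z →
               (b + c) * x − (θ − a) * y ≈ (c * x + a * y + b * z − θ * y) + - b * (z − x)
    identity = solve 7 (λ a b c θ x y z → (b :+ c) :* x :- (θ :- a) :* y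
                                       := (c :* x :+ a :* y :+ b :* z :- θ :* y) :+ :- b :* (z :- x)) refl

  cross-quadratic : ∀ {ε m α β x y r s} → m * x ≈ α * y → m * r ≈ β * s → Cross ε x y r s →
                    s * y * (m * m − ε * m * (α − β) − α * β) ≈ 0#
  cross-quadratic {ε} {m} {α} {β} {x} {y} {r} {s} mx≈αy mr≈βs c =
    trans (identity ε m α β x y r s)
          (m * m ⊛ x≈y⇒x−y≈0 c ⊕ (ε * m + β) * s ⊛ x≈y⇒x−y≈0 mx≈αy
           ⊕ m * (x − ε * y) ⊛ x≈y⇒x−y≈0 mr≈βs)
    where
    identity : ∀ ε m α β x y r s →
               s * y * (m * m − ε * m * (α − β) − α * β)
                 ≈ m * m * (s * (y − ε * x) − r * (x − ε * y)) + (ε * m + β) * s * (m * x − α * y)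
                   + m * (x − ε * y) * (m * r − β * s)
    identity = solve 8 (λ ε m α β x y r s →
      s :* y :* (m :* m :- ε :* m :* (α :- β) :- α :* β)
        := m :* m :* (s :* (y :- ε :* x) :- r :* (x :- ε :* y)) :+ (ε :* m :+ β) :* s :* (m :* x :- α :* y)
           :+ m :* (x :- ε :* y) :* (m :* r :- β :* s)) refl

  a*[k−θ]*[k−θ′]≈0 : ∀ {ε a b c k θ θ′} → k ≈ c + a + b →
    (b + c) * (b + c) − ε * (b + c) * ((θ − a) − (θ′ − a)) − (θ − a) * (θ′ − a) ≈ 0# →
    θ * θ′ − k * k − ε * k * (θ′ − θ) ≈ 0# →
    a * ((k − θ) * (k − θ′)) ≈ 0#
  a*[k−θ]*[k−θ′]≈0 {ε} {a} {b} {c} {k} {θ} {θ′} k≈c+a+b quadratic kl =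
    trans (identity ε a b c k θ θ′)
          (- (k * (b + c − a) + θ * θ′) ⊛ x≈y⇒x−y≈0 k≈c+a+b ⊕ - k ⊛ quadratic ⊕ - (b + c) ⊛ kl)
    where
    identity : ∀ ε a b c k θ θ′ →
      a * ((k − θ) * (k − θ′))
        ≈ - (k * (b + c − a) + θ * θ′) * (k − (c + a + b))
          + - k * ((b + c) * (b + c) − ε * (b + c) * ((θ − a) − (θ′ − a)) − (θ − a) * (θ′ − a))
          + - (b + c) * (θ * θ′ − k * k − ε * k * (θ′ − θ))
    identity = solve 7 (λ ε a b c k θ θ′ →
      a :* ((k :- θ) :* (k :- θ′))
        := :- (k :* (b :+ c :- a) :+ θ :* θ′) :* (k :- (c :+ a :+ b))
           :+ :- k :* ((b :+ c) :* (b :+ c) :- ε :* (b :+ c) :* ((θ :- a) :- (θ′ :- a))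
                       :- (θ :- a) :* (θ′ :- a))
           :+ :- (b :+ c) :* (θ :* θ′ :- k :* k :- ε :* k :* (θ′ :- θ))) refl

¬T⇒T-not : ∀ {b} → ¬ T b → T (not b)
¬T⇒T-not {false} _  = _
¬T⇒T-not {true}  ¬t = ⊥-elim (¬t _)

module Distance (G : Graph) where
  open ≡ using (refl; sym; subst)
  open Graph G renaming (sym to adj-sym)

  Adj : Fin n → Fin n → Set
  Adj x y = T (adj x y)

  -- The Boolean tests of Defs wrapped in records, so that the indices can be inferred.
  record Reach (l : ℕ) (x y : Fin n) : Set where
    constructor mkReach
    field reach-holds : T (reach G l x y)
  open Reach public

  record Dist (x y : Fin n) (i : ℕ) : Set where
    constructor mkDist
    field dist-holds : T (isDist G x y i)
  open Dist public

  reach-refl : ∀ {x} → Reach 0 x x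
  reach-refl = mkReach (fromWitness refl)

  reach-zero⇒≡ : ∀ {x y} → Reach 0 x y → x ≡ y
  reach-zero⇒≡ (mkReach r) = toWitness r

  reach-suc : ∀ {l x y} → Reach l x y → Reach (suc l) x y
  reach-suc (mkReach r) = mkReach (from T-∨ (inj₁ r))

  reach-snoc : ∀ {l x y z} → Reach l x y → Adj y z → Reach (suc l) x z
  reach-snoc {y = y} (mkReach r) a =
    mkReach (from T-∨ (inj₂ (any⁺ _ (lose (∈-allFin y) (from T-∧ (r , a))))))

  reach-suc⁻ : ∀ {l x z} → Reach (suc l) x z → Reach l x z ⊎ ∃[ y ] Reach l x y × Adj y z
  reach-suc⁻ (mkReach r) with to T-∨ r
  ... | inj₁ r′ = inj₁ (mkReach r′)
  ... | inj₂ any-y with satisfied (any⁻ _ (allFin n) any-y)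
  ...   | y , ry∧a = let (ry , a) = to T-∧ ry∧a in inj₂ (y , mkReach ry , a)

  reach-cons : ∀ {l x y z} → Adj x y → Reach l y z → Reach (suc l) x z
  reach-cons {zero} a r with reach-zero⇒≡ r
  ... | refl = reach-snoc reach-refl a
  reach-cons {suc l} a r with reach-suc⁻ r
  ... | inj₁ r′ = reach-suc (reach-cons a r′)
  ... | inj₂ (w , r′ , a′) = reach-snoc (reach-cons a r′) a′

  reach-sym : ∀ {l x y} → Reach l x y → Reach l y x
  reach-sym {zero} r with reach-zero⇒≡ r
  ... | refl = r
  reach-sym {suc l} {x} {y} r with reach-suc⁻ r
  ... | inj₁ r′ = reach-suc (reach-sym r′)
  ... | inj₂ (w , r′ , a) = reach-cons (subst T (adj-sym w y) a) (reach-sym r′)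

  reach-mono : ∀ {l m x y} → l ≤ m → Reach l x y → Reach m x y
  reach-mono = go ∘ ≤⇒≤′
    where
    go : ∀ {l m x y} → l ≤′ m → Reach l x y → Reach m x y
    go ≤′-refl        r = r
    go (≤′-step l≤′m) r = reach-suc (go l≤′m r)

  dist-refl : ∀ {x} → Dist x x 0
  dist-refl = mkDist (reach-holds reach-refl)

  dist⇒reach : ∀ {i x y} → Dist x y i → Reach i x y
  dist⇒reach {zero}  (mkDist d) = mkReach d
  dist⇒reach {suc i} (mkDist d) = mkReach (proj₁ (to T-∧ d))

  dist⇒¬reach : ∀ {i x y} → Dist x y (suc i) → ¬ Reach i x y
  dist⇒¬reach (mkDist d) (mkReach r) with to T-not-≡ (proj₂ (to T-∧ d))
  ... | r≡false = subst T r≡false r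

  dist-suc : ∀ {i x y} → Reach (suc i) x y → ¬ Reach i x y → Dist x y (suc i)
  dist-suc r ¬r = mkDist (from T-∧ (reach-holds r , ¬T⇒T-not (¬r ∘ mkReach)))

  reach⇒dist : ∀ {l x y} → Reach l x y → ∃[ i ] i ≤ l × Dist x y i
  reach⇒dist {zero}  (mkReach r) = 0 , z≤n , mkDist r
  reach⇒dist {suc l} {x} {y} r with T? (reach G l x y)
  ... | yes r′ = let (i , i≤l , d) = reach⇒dist (mkReach r′) in i , m≤n⇒m≤1+n i≤l , d
  ... | no ¬r′ = suc l , ≤-refl , dist-suc r (¬r′ ∘ reach-holds)

  dist-minimal : ∀ {i j x y} → Dist x y i → Reach j x y → i ≤ j
  dist-minimal {zero} d r = z≤n
  dist-minimal {suc i} {j} d r with suc i ≤? j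
  ... | yes i<j = i<j
  ... | no  i≮j = ⊥-elim (dist⇒¬reach d (reach-mono (≤-pred (≰⇒> i≮j)) r))

  dist-unique : ∀ {i j x y} → Dist x y i → Dist x y j → i ≡ j
  dist-unique d e = ≤-antisym (dist-minimal d (dist⇒reach e)) (dist-minimal e (dist⇒reach d))

  dist-sym : ∀ {i x y} → Dist x y i → Dist y x i
  dist-sym {i} {x} {y} d with reach⇒dist (reach-sym (dist⇒reach d))
  ... | j , j≤i , e = subst (Dist y x) (≤-antisym j≤i (dist-minimal d (reach-sym (dist⇒reach e)))) e

  dist-geodesic : ∀ {m x x′ y} → Adj x x′ → Dist x y (suc m) → Reach m x′ y → Dist x′ y m
  dist-geodesic a d r with reach⇒dist r
  ... | j , j≤m , e =
    subst (Dist _ _) (≤-antisym j≤m (≤-pred (dist-minimal d (reach-cons a (dist⇒reach e))))) e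

  dist-predecessor : ∀ {m x z} → Dist x z (suc m) → ∃[ y ] Dist x y m × Adj y z
  dist-predecessor {z = z} d with reach-suc⁻ (dist⇒reach d)
  ... | inj₁ r = ⊥-elim (dist⇒¬reach d r)
  ... | inj₂ (y , r , a) =
    y , dist-sym (dist-geodesic (subst T (adj-sym y z) a) (dist-sym d) (reach-sym r)) , a

  adj⇒dist₁ : ∀ {x y} → Adj x y → Dist x y 1
  adj⇒dist₁ {x} {y} a = mkDist (from T-∧ (reach-holds (reach-snoc reach-refl a) , ¬T⇒T-not x≢y))
    where
    x≢y : ¬ T (reach G 0 x y)
    x≢y r with reach-zero⇒≡ (mkReach r)
    ... | refl = subst T (irrefl x) a

  dist₁⇒adj : ∀ {x y} → Dist x y 1 → Adj x y
  dist₁⇒adj d with dist-predecessor d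
  ... | y , e , a with reach-zero⇒≡ (dist⇒reach e)
  ...   | refl = a

  dist-neighbour : ∀ {j x y z} → Dist x y j → Adj y z →
                   ∃[ j′ ] Dist x z j′ × j′ ≤ suc j × j ≤ suc j′
  dist-neighbour {y = y} {z} d a with reach⇒dist (reach-snoc (dist⇒reach d) a)
  ... | j′ , j′≤1+j , e =
    j′ , e , j′≤1+j , dist-minimal d (reach-snoc (dist⇒reach e) (subst T (adj-sym y z) a))

  isDist-true : ∀ {i x y} → Dist x y i → isDist G x y i ≡ true
  isDist-true d = to T-≡ (dist-holds d)

  isDist-false : ∀ {i j x y} → Dist x y i → j ≢ i → isDist G x y j ≡ false
  isDist-false {j = j} {x} {y} d j≢i with isDist G x y j in eq
  ... | true  = ⊥-elim (j≢i (dist-unique (mkDist (from T-≡ eq)) d))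
  ... | false = refl

indicator : Bool → ℕ
indicator true  = 1
indicator false = 0

module Counting {a} {A : Set a} where
  open import Data.Nat using (_+_)
  open ≡ using (refl)

  count : (A → Bool) → List A → ℕ
  count g xs = length (filter (λ x → g x ≟ᵇ true) xs)

  count-cons : ∀ g x xs → count g (x ∷ xs) ≡ indicator (g x) + count g xs
  count-cons g x xs with g x
  ... | true  = refl
  ... | false = refl

  count-pos : ∀ g {x xs} → x ∈ xs → T (g x) → 1 ≤ count g xs
  count-pos g x∈xs gx = nonempty (∈-filter⁺ (λ x → _ ≟ᵇ true) x∈xs (to T-≡ gx))
    where
    nonempty : ∀ {x} {ys : List A} → x ∈ ys → 1 ≤ length ys
    nonempty {ys = _ ∷ _} _ = s≤s z≤n

  count-witness : ∀ g xs → count g xs ≢ 0 → ∃[ x ] T (g x)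
  count-witness g []       c≢0 = ⊥-elim (c≢0 refl)
  count-witness g (x ∷ xs) c≢0 with g x in gx
  ... | true  = x , from T-≡ gx
  ... | false = count-witness g xs c≢0

  count-none : ∀ g xs → (∀ x → ¬ T (g x)) → count g xs ≡ 0
  count-none g []       none = refl
  count-none g (x ∷ xs) none with g x in gx
  ... | true  = ⊥-elim (none x (from T-≡ gx))
  ... | false = count-none g xs none

  count-split₃ : ∀ g h₁ h₂ h₃ →
                 (∀ x → indicator (g x) ≡ indicator (h₁ x) + indicator (h₂ x) + indicator (h₃ x)) →
                 ∀ xs → count g xs ≡ count h₁ xs + count h₂ xs + count h₃ xs
  count-split₃ g h₁ h₂ h₃ split [] = refl
  count-split₃ g h₁ h₂ h₃ split (x ∷ xs)
    rewrite count-cons g x xs | count-cons h₁ x xs | count-cons h₂ x xs | count-cons h₃ x xs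
          | split x | count-split₃ g h₁ h₂ h₃ split xs =
      interchange (indicator (h₁ x)) (indicator (h₂ x)) (indicator (h₃ x))
                  (count h₁ xs) (count h₂ xs) (count h₃ xs)
    where
    open import Data.Nat.Tactic.RingSolver using (solve-∀)
    interchange : ∀ a b c d e f → a + b + c + (d + e + f) ≡ a + d + (b + e) + (c + f)
    interchange = solve-∀

cases₃ : ∀ {i j} → i ≤ j → j ≤ suc (suc i) → j ≡ i ⊎ j ≡ suc i ⊎ j ≡ suc (suc i)
cases₃ i≤j j≤2+i with m≤n⇒m<n∨m≡n j≤2+i
... | inj₂ j≡2+i = inj₂ (inj₂ j≡2+i)
... | inj₁ (s≤s j≤1+i) with m≤n⇒m<n∨m≡n j≤1+i
...   | inj₂ j≡1+i     = inj₂ (inj₁ j≡1+i)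
...   | inj₁ (s≤s j≤i) = inj₁ (≤-antisym j≤i i≤j)

c*b<[a+a+c]*[b+a′+a′] : ∀ {a a′} b c → 1 ≤ a′ → 1 ≤ a →
                        c ℕ.* b < (a ℕ.+ a ℕ.+ c) ℕ.* (b ℕ.+ a′ ℕ.+ a′)
c*b<[a+a+c]*[b+a′+a′] {a} {a′} b c 1≤a′ 1≤a = begin-strict
  c ℕ.* b                               <⟨ n<1+n _ ⟩
  1 ℕ.+ c ℕ.* b                         ≤⟨ +-mono-≤ (*-mono-≤ 1≤a+a 1≤X) (*-monoʳ-≤ c b≤X) ⟩
  (a ℕ.+ a) ℕ.* X ℕ.+ c ℕ.* X           ≡⟨ *-distribʳ-+ X (a ℕ.+ a) c ⟨
  (a ℕ.+ a ℕ.+ c) ℕ.* X                 ∎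
  where
  open ≤-Reasoning
  X : ℕ
  X = b ℕ.+ a′ ℕ.+ a′
  1≤a+a : 1 ≤ a ℕ.+ a
  1≤a+a = ≤-trans 1≤a (m≤m+n a a)
  1≤X : 1 ≤ X
  1≤X = ≤-trans 1≤a′ (m≤n+m a′ (b ℕ.+ a′))
  b≤X : b ≤ X
  b≤X = ≤-trans (m≤m+n b a′) (m≤m+n (b ℕ.+ a′) a′)

record IntersectionFacts (D : ℕ) (p : ℕ → ℕ → ℕ → ℕ) : Set where
  open Intersection p
  field
    a₀≡0    : aᵢ 0 ≡ 0
    cᵢ-pos  : ∀ i → suc i ≤ D → 1 ≤ cᵢ (suc i)
    aᵢ-pos  : ∀ i → suc (suc i) ≤ D → 1 ≤ aᵢ (suc i)
    k≡c+a+b : ∀ i → suc (suc i) ≤ D → k ≡ cᵢ (suc i) ℕ.+ aᵢ (suc i) ℕ.+ bᵢ (suc i)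

module DistanceRegularProperties (G : Graph) {D : ℕ} {p : ℕ → ℕ → ℕ → ℕ}
                                 (drg : IsDistanceRegular G D p) where
  open Graph G renaming (sym to adj-sym)
  open Distance G
  open Counting
  open Intersection p
  open import Data.Nat using (_+_)
  open ≡ using (refl; sym; trans; cong₂; subst; module ≡-Reasoning)

  common-count : ∀ {h i j x y} → h ≤ D → i ≤ D → j ≤ D → Dist x y h →
                 count (λ z → isDist G x z i ∧ isDist G y z j) (allFin n) ≡ p h i j
  common-count h≤D i≤D j≤D dxy = proj₂ drg _ _ _ h≤D i≤D j≤D _ _ (isDist-true dxy)

  p-pos : ∀ {h i j x y z} → h ≤ D → i ≤ D → j ≤ D → Dist x y h → Dist x z i → Dist y z j →
          1 ≤ p h i j
  p-pos {i = i} {j} {x} {y} {z} h≤D i≤D j≤D dxy dxz dyz =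
    subst (1 ≤_) (common-count h≤D i≤D j≤D dxy)
          (count-pos (λ w → isDist G x w i ∧ isDist G y w j) (∈-allFin z)
                     (from T-∧ (dist-holds dxz , dist-holds dyz)))

  p-witness : ∀ {h i j x y} → h ≤ D → i ≤ D → j ≤ D → Dist x y h → p h i j ≢ 0 →
              ∃[ z ] Dist x z i × Dist y z j
  p-witness h≤D i≤D j≤D dxy p≢0
    with count-witness _ (allFin n) (p≢0 ∘ trans (sym (common-count h≤D i≤D j≤D dxy)))
  ... | z , dxz∧dyz = let (dxz , dyz) = to T-∧ dxz∧dyz in z , mkDist dxz , mkDist dyz

  dist-pair : ∀ {i} → i ≤ D → ∃₂ λ x y → Dist x y i
  dist-pair = shorten diameter-pair
    where
    diameter-pair : Dist _ _ D
    diameter-pair = mkDist (from T-≡ (proj₂ (proj₂ (proj₂ (proj₁ drg)))))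
    shorten : ∀ {m i x y} → Dist x y m → i ≤ m → ∃₂ λ x y → Dist x y i
    shorten d i≤m with m≤n⇒m<n∨m≡n i≤m
    ... | inj₂ refl       = _ , _ , d
    ... | inj₁ (s≤s i≤m′) = shorten (proj₁ (proj₂ (dist-predecessor d))) i≤m′

  a₀≡0 : 1 ≤ D → aᵢ 0 ≡ 0
  a₀≡0 1≤D with dist-pair z≤n
  ... | x , _ , _ = trans (sym (common-count z≤n 1≤D z≤n (dist-refl {x}))) (count-none _ (allFin n) not-both)
    where
    not-both : ∀ z → ¬ T (isDist G x z 1 ∧ isDist G x z 0)
    not-both z d₁∧d₀ with to (T-∧ {isDist G x z 1}) d₁∧d₀
    ... | d₁ , d₀ with dist-unique {1} {0} {x} {z} (mkDist d₁) (mkDist d₀)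
    ...   | ()

  cᵢ-pos : ∀ i → suc i ≤ D → 1 ≤ cᵢ (suc i)
  cᵢ-pos i 1+i≤D with dist-pair 1+i≤D
  ... | x , y , dxy with dist-predecessor (dist-sym dxy)
  ...   | z , dyz , z~x = p-pos 1+i≤D (≤-trans (s≤s z≤n) 1+i≤D) (≤-trans (n≤1+n i) 1+i≤D)
                                dxy (dist-sym (adj⇒dist₁ z~x)) dyz

  -- Take ∂(x,z) = i + 1, y the neighbour of z towards x, and w a common neighbour of y and z.
  -- If ∂(x,w) = i then w is counted by aᵢ at (y, x); otherwise ∂(x,w) = i + 1 and w is counted
  -- by aᵢ at (z, x₁), for x₁ the neighbour of x towards y.
  aᵢ-pos : aᵢ 1 ≢ 0 → ∀ i → suc (suc i) ≤ D → 1 ≤ aᵢ (suc i)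
  aᵢ-pos a₁≢0 i 2+i≤D =
    let x , z , dxz     = dist-pair 2+i≤D
        y , dxy , y~z   = dist-predecessor dxz
        w , dyw , dzw   = p-witness 1≤D 1≤D 1≤D (adj⇒dist₁ y~z) a₁≢0
        x₁ , dyx₁ , x₁~x = dist-predecessor (dist-sym dxy)
        x~x₁            = subst T (adj-sym x₁ x) x₁~x
        x₁⇝y            = dist⇒reach (dist-sym dyx₁)
    in case T? (reach G (suc i) x w) of λ where
      (yes x⇝w) → p-pos 1+i≤D 1≤D 1+i≤D (dist-sym dxy) dyw
                    (dist-sym (dist-geodesic (dist₁⇒adj dzw) (dist-sym dxz) (reach-sym (mkReach x⇝w))))
      (no x⇝̸w)  →
        let dxw = dist-suc (reach-snoc (dist⇒reach dxy) (dist₁⇒adj dyw)) (x⇝̸w ∘ reach-holds)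
        in p-pos 1+i≤D 1≤D 1+i≤D (dist-sym (dist-geodesic x~x₁ dxz (reach-snoc x₁⇝y y~z))) dzw
                 (dist-geodesic x~x₁ dxw (reach-snoc x₁⇝y (dist₁⇒adj dyw)))
    where
    1≤D : 1 ≤ D
    1≤D = ≤-trans (s≤s z≤n) 2+i≤D
    1+i≤D : suc i ≤ D
    1+i≤D = ≤-trans (n≤1+n _) 2+i≤D

  -- The neighbours z of x split according to ∂(y,z) ∈ {i, i + 1, i + 2}, where ∂(x,y) = i + 1.
  k≡c+a+b : ∀ i → suc (suc i) ≤ D → k ≡ cᵢ (suc i) + aᵢ (suc i) + bᵢ (suc i)
  k≡c+a+b i 2+i≤D with dist-pair (≤-trans (n≤1+n _) 2+i≤D)
  ... | x , y , dxy = begin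
    k
      ≡⟨ common-count z≤n 1≤D 1≤D (dist-refl {x}) ⟨
    count (λ z → isDist G x z 1 ∧ isDist G x z 1) (allFin n)
      ≡⟨ count-split₃ _ (at i) (at (suc i)) (at (suc (suc i))) split (allFin n) ⟩
    count (at i) (allFin n) + count (at (suc i)) (allFin n) + count (at (suc (suc i))) (allFin n)
      ≡⟨ cong₂ _+_ (cong₂ _+_ (common-count 1+i≤D 1≤D i≤D dxy) (common-count 1+i≤D 1≤D 1+i≤D dxy))
                   (common-count 1+i≤D 1≤D 2+i≤D dxy) ⟩
    cᵢ (suc i) + aᵢ (suc i) + bᵢ (suc i)
      ∎
    where
    open ≡-Reasoning
    at : ℕ → Fin n → Bool
    at j z = isDist G x z 1 ∧ isDist G y z j
    1≤D : 1 ≤ D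
    1≤D = ≤-trans (s≤s z≤n) 2+i≤D
    1+i≤D : suc i ≤ D
    1+i≤D = ≤-trans (n≤1+n _) 2+i≤D
    i≤D : i ≤ D
    i≤D = ≤-trans (n≤1+n _) 1+i≤D
    split : ∀ z → indicator (isDist G x z 1 ∧ isDist G x z 1)
                    ≡ indicator (at i z) + indicator (at (suc i) z) + indicator (at (suc (suc i)) z)
    split z with isDist G x z 1 in x~z
    ... | false = refl
    ... | true with dist-neighbour (dist-sym dxy) (dist₁⇒adj (mkDist (from T-≡ x~z)))
    ...   | j , dyz , j≤2+i , 1+i≤1+j with cases₃ (≤-pred 1+i≤1+j) j≤2+i
    ...     | inj₁ refl
      rewrite isDist-true dyz
            | isDist-false dyz (>⇒≢ (n<1+n j))
            | isDist-false dyz (>⇒≢ (m<n⇒m<1+n (n<1+n j))) = refl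
    ...     | inj₂ (inj₁ refl)
      rewrite isDist-false dyz (<⇒≢ (n<1+n i))
            | isDist-true dyz
            | isDist-false dyz (>⇒≢ (n<1+n j)) = refl
    ...     | inj₂ (inj₂ refl)
      rewrite isDist-false dyz (<⇒≢ (m<n⇒m<1+n (n<1+n i)))
            | isDist-false dyz (<⇒≢ (n<1+n (suc i)))
            | isDist-true dyz = refl

  intersection-facts : 1 ≤ D → aᵢ 1 ≢ 0 → IntersectionFacts D p
  intersection-facts 1≤D a₁≢0 = record
    { a₀≡0 = a₀≡0 1≤D ; cᵢ-pos = cᵢ-pos ; aᵢ-pos = aᵢ-pos a₁≢0 ; k≡c+a+b = k≡c+a+b }

module PseudoCosineProperties {f ℓ} (F : OrderedField f ℓ) {D p} (facts : IntersectionFacts D p) where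
  open OrderedField F
  open OrderedFieldProperties F
  open IntegerCoefficientSolver commutativeRing
  open PseudoCosine F D p
  open IntersectionFacts facts
  open import Relation.Binary.Reasoning.Setoid setoid
  private module I = Intersection p

  a b c : ℕ → Carrier
  a i = fromℕ (I.aᵢ i)
  b i = fromℕ (I.bᵢ i)
  c i = fromℕ (I.cᵢ i)

  k : Carrier
  k = fromℕ I.k

  c≉0 : ∀ i → suc i ≤ D → ¬ c (suc i) ≈ 0#
  c≉0 i 1+i≤D = fromℕ≉0 (cᵢ-pos i 1+i≤D)

  a≉0 : ∀ i → suc (suc i) ≤ D → ¬ a (suc i) ≈ 0#
  a≉0 i 2+i≤D = fromℕ≉0 (aᵢ-pos i 2+i≤D)

  k≈c+a+b : ∀ i → suc (suc i) ≤ D → k ≈ c (suc i) + a (suc i) + b (suc i)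
  k≈c+a+b i 2+i≤D =
    trans (reflexive (≡.cong fromℕ (k≡c+a+b i 2+i≤D)))
          (fromℕ-+₃ (I.cᵢ (suc i)) (I.aᵢ (suc i)) (I.bᵢ (suc i)))

  module _ {σ θ} (σ-pcs : IsPCSFor σ θ) where

    σ₀≈1 : σ 0 ≈ 1#
    σ₀≈1 = proj₁ σ-pcs

    recurrence : ∀ i → suc (suc i) ≤ D →
                 c (suc i) * σ i + a (suc i) * σ (suc i) + b (suc i) * σ (suc (suc i)) ≈ θ * σ (suc i)
    recurrence i = proj₂ σ-pcs (suc i)

    k*σ₁≈θ : 1 ≤ D → k * σ 1 ≈ θ
    k*σ₁≈θ 1≤D = begin
      k * σ 1              ≈⟨ +-identityˡ _ ⟨
      0# + k * σ 1         ≈⟨ +-congʳ a₀σ₀≈0 ⟨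
      a 0 * σ 0 + k * σ 1  ≈⟨ proj₂ σ-pcs 0 1≤D ⟩
      θ * σ 0              ≈⟨ *-congˡ σ₀≈1 ⟩
      θ * 1#               ≈⟨ *-identityʳ θ ⟩
      θ                    ∎
      where
      a₀σ₀≈0 : a 0 * σ 0 ≈ 0#
      a₀σ₀≈0 = trans (*-congʳ (reflexive (≡.cong fromℕ a₀≡0))) (zeroˡ _)

    no-adjacent-zeros : ∀ i → suc i ≤ D → σ i ≈ 0# → σ (suc i) ≈ 0# → ⊥
    no-adjacent-zeros zero    _     σ₀≈0   _      = 1≉0 (trans (sym σ₀≈1) σ₀≈0)
    no-adjacent-zeros (suc i) 2+i≤D σ₁₊ᵢ≈0 σ₂₊ᵢ≈0 =
      no-adjacent-zeros i 1+i≤D (x*y≈0⇒y≈0 (c≉0 i 1+i≤D) cσᵢ≈0) σ₁₊ᵢ≈0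
      where
      1+i≤D : suc i ≤ D
      1+i≤D = ≤-trans (n≤1+n _) 2+i≤D
      identity : ∀ c a b θ x y z → c * x ≈ (c * x + a * y + b * z − θ * y) + (θ − a) * y + - b * z
      identity = solve 7 (λ c a b θ x y z →
        c :* x := (c :* x :+ a :* y :+ b :* z :- θ :* y) :+ (θ :- a) :* y :+ :- b :* z) refl
      cσᵢ≈0 : c (suc i) * σ i ≈ 0#
      cσᵢ≈0 = trans (identity (c (suc i)) (a (suc i)) (b (suc i)) θ (σ i) (σ (suc i)) (σ (suc (suc i))))
                    (x≈y⇒x−y≈0 (recurrence i 2+i≤D) ⊕ (θ − a (suc i)) ⊛ σ₁₊ᵢ≈0
                     ⊕ - b (suc i) ⊛ σ₂₊ᵢ≈0)

    nontrivial⇒θ≉k : Nontrivial σ → ¬ θ ≈ k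
    nontrivial⇒θ≉k nontrivial θ≈k =
      nontrivial (σ₀≈1 , λ i 1+i≤D → trans (proj₂ σ-pcs i 1+i≤D) (*-congʳ θ≈k))

    θ≉k⇒σ₁≉1 : 1 ≤ D → ¬ θ ≈ k → ¬ σ 1 ≈ 1#
    θ≉k⇒σ₁≉1 1≤D θ≉k σ₁≈1 = θ≉k (begin
      θ        ≈⟨ k*σ₁≈θ 1≤D ⟨
      k * σ 1  ≈⟨ *-congˡ σ₁≈1 ⟩
      k * 1#   ≈⟨ *-identityʳ k ⟩
      k        ∎)

module TightPairProperties {f ℓ} (F : OrderedField f ℓ) {D p} (facts : IntersectionFacts D p)
                           (3≤D : 3 ≤ D) where
  open OrderedField F
  open OrderedFieldProperties F
  open IntegerCoefficientSolver commutativeRing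
  open TightPairAlgebra F
  open PseudoCosine F D p
  open PseudoCosineProperties F facts
  open IntersectionFacts facts
  open import Algebra.Properties.Ring ring using (+-inverseʳ-unique; -‿involutive)
  open import Relation.Binary.Reasoning.Setoid setoid
  private module I = Intersection p

  private
    1≤D : 1 ≤ D
    1≤D = ≤-trans (s≤s z≤n) 3≤D
    2≤D : 2 ≤ D
    2≤D = ≤-trans (s≤s (s≤s z≤n)) 3≤D

  Balanced : Carrier → (ℕ → Carrier) → (ℕ → Carrier) → Set ℓ
  Balanced ε σ ρ = ∀ i → suc i ≤ D →
    σ (suc i) * ρ (suc i) − σ i * ρ i ≈ ε * (σ i * ρ (suc i) − σ (suc i) * ρ i)

  balanced-cong : ∀ {ε ε′ σ ρ} → ε ≈ ε′ → Balanced ε σ ρ → Balanced ε′ σ ρ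
  balanced-cong ε≈ε′ bal i 1+i≤D = trans (bal i 1+i≤D) (*-congʳ ε≈ε′)

  balanced-swap : ∀ {ε σ ρ} → Balanced ε σ ρ → Balanced (- ε) ρ σ
  balanced-swap {ε} {σ} {ρ} bal i 1+i≤D =
    x−y≈0⇒x≈y (trans (identity ε (σ i) (σ (suc i)) (ρ i) (ρ (suc i))) (x≈y⇒x−y≈0 (bal i 1+i≤D)))
    where
    identity : ∀ ε x y r s →
               (s * y − r * x) − - ε * (r * y − s * x) ≈ (y * s − x * r) − ε * (x * s − y * r)
    identity = solve 5 (λ ε x y r s → (s :* y :- r :* x) :- :- ε :* (r :* y :- s :* x)
                                   := (y :* s :- x :* r) :- ε :* (x :* s :- y :* r)) refl

  eigenvalue-relation : ∀ {σ ρ θ θ′ ε} → IsPCSFor σ θ → IsPCSFor ρ θ′ → Balanced ε σ ρ →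
                        θ * θ′ − k * k − ε * k * (θ′ − θ) ≈ 0#
  eigenvalue-relation {σ} {ρ} {θ} {θ′} {ε} σ-pcs ρ-pcs bal =
    trans (identity k (σ 0) (σ 1) (ρ 0) (ρ 1) ε θ θ′)
      (k * k ⊛ x≈y⇒x−y≈0 (bal 0 1≤D)
       ⊕ (k * k + ε * k * (k * ρ 1)) ⊛ x≈y⇒x−y≈0 (σ₀≈1 σ-pcs)
       ⊕ (k * k * σ 0 − ε * k * (k * σ 1)) ⊛ x≈y⇒x−y≈0 (σ₀≈1 ρ-pcs)
       ⊕ (- θ′ − ε * k) ⊛ x≈y⇒x−y≈0 (k*σ₁≈θ σ-pcs 1≤D)
       ⊕ (ε * k − k * σ 1) ⊛ x≈y⇒x−y≈0 (k*σ₁≈θ ρ-pcs 1≤D))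
    where
    identity : ∀ k σ₀ σ₁ ρ₀ ρ₁ ε θ θ′ →
      θ * θ′ − k * k − ε * k * (θ′ − θ)
        ≈ k * k * ((σ₁ * ρ₁ − σ₀ * ρ₀) − ε * (σ₀ * ρ₁ − σ₁ * ρ₀))
          + (k * k + ε * k * (k * ρ₁)) * (σ₀ − 1#)
          + (k * k * σ₀ − ε * k * (k * σ₁)) * (ρ₀ − 1#)
          + (- θ′ − ε * k) * (k * σ₁ − θ)
          + (ε * k − k * σ₁) * (k * ρ₁ − θ′)
    identity = solve 8 (λ k σ₀ σ₁ ρ₀ ρ₁ ε θ θ′ →
      θ :* θ′ :- k :* k :- ε :* k :* (θ′ :- θ)
        := k :* k :* ((σ₁ :* ρ₁ :- σ₀ :* ρ₀) :- ε :* (σ₀ :* ρ₁ :- σ₁ :* ρ₀))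
           :+ (k :* k :+ ε :* k :* (k :* ρ₁)) :* (σ₀ :- :1)
           :+ (k :* k :* σ₀ :- ε :* k :* (k :* σ₁)) :* (ρ₀ :- :1)
           :+ (:- θ′ :- ε :* k) :* (k :* σ₁ :- θ)
           :+ (ε :* k :- k :* σ₁) :* (k :* ρ₁ :- θ′)) refl

  -- For ε = 1 the relation at i reads (σᵢ₊₁ − σᵢ) (ρᵢ₊₁ + ρᵢ) ≈ 0.  At i = 0 this forces ρ₁ = −1,
  -- hence θ′ = −k and b₁ ρ₂ = b₁ + 2 a₁; at i = 1 then σ₂ = σ₁ and c₁ + k σ₁ = 0; at i = 2 either
  -- σ₃ = σ₂, giving σ₁ = 0 and c₁ = 0, or ρ₃ = −ρ₂, giving (2 a₂ + c₂)(b₁ + 2 a₁) = c₂ b₁ in ℕ.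
  private
    module BalancedAtOne {σ ρ θ θ′} (σ-pcs : IsPCSFor σ θ) (ρ-pcs : IsPCSFor ρ θ′) (θ≉k : ¬ θ ≈ k)
                         (bal : Balanced 1# σ ρ) where

      step : ∀ i → suc i ≤ D → (σ (suc i) − σ i) * (ρ (suc i) + ρ i) ≈ 0#
      step i 1+i≤D =
        trans (identity (σ i) (σ (suc i)) (ρ i) (ρ (suc i))) (x≈y⇒x−y≈0 (bal i 1+i≤D))
        where
        identity : ∀ x y r s → (y − x) * (s + r) ≈ (y * s − x * r) − 1# * (x * s − y * r)
        identity = solve 4 (λ x y r s → (y :- x) :* (s :+ r)
                                     := (y :* s :- x :* r) :- :1 :* (x :* s :- y :* r)) refl

      ρ₁+1≈0 : ρ 1 + 1# ≈ 0#
      ρ₁+1≈0 = x*y≈0⇒y≈0 (θ≉k⇒σ₁≉1 σ-pcs 1≤D θ≉k ∘ x−y≈0⇒x≈y)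
        (trans (*-cong (+-congˡ (-‿cong (sym (σ₀≈1 σ-pcs)))) (+-congˡ (sym (σ₀≈1 ρ-pcs)))) (step 0 1≤D))

      θ′+k≈0 : θ′ + k ≈ 0#
      θ′+k≈0 =
        trans (identity k (ρ 1) θ′) (- 1# ⊛ x≈y⇒x−y≈0 (k*σ₁≈θ ρ-pcs 1≤D) ⊕ k ⊛ ρ₁+1≈0)
        where
        identity : ∀ k ρ₁ θ′ → θ′ + k ≈ - 1# * (k * ρ₁ − θ′) + k * (ρ₁ + 1#)
        identity = solve 3 (λ k ρ₁ θ′ →
          θ′ :+ k := :- :1 :* (k :* ρ₁ :- θ′) :+ k :* (ρ₁ :+ :1)) refl

      b₁ρ₂≈b₁+2a₁ : b 1 * ρ 2 − (b 1 + a 1 + a 1) ≈ 0#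
      b₁ρ₂≈b₁+2a₁ =
        trans (identity (c 1) (a 1) (b 1) k (ρ 0) (ρ 1) (ρ 2) θ′)
          (x≈y⇒x−y≈0 (recurrence ρ-pcs 0 2≤D) ⊕ - c 1 ⊛ x≈y⇒x−y≈0 (σ₀≈1 ρ-pcs)
           ⊕ - (a 1 + k) ⊛ ρ₁+1≈0 ⊕ ρ 1 ⊛ θ′+k≈0 ⊕ x≈y⇒x−y≈0 (k≈c+a+b 0 2≤D))
        where
        identity : ∀ c a b k ρ₀ ρ₁ ρ₂ θ′ →
          b * ρ₂ − (b + a + a)
            ≈ (c * ρ₀ + a * ρ₁ + b * ρ₂ − θ′ * ρ₁) + - c * (ρ₀ − 1#) + - (a + k) * (ρ₁ + 1#)
              + ρ₁ * (θ′ + k) + (k − (c + a + b))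
        identity = solve 8 (λ c a b k ρ₀ ρ₁ ρ₂ θ′ →
          b :* ρ₂ :- (b :+ a :+ a)
            := (c :* ρ₀ :+ a :* ρ₁ :+ b :* ρ₂ :- θ′ :* ρ₁) :+ :- c :* (ρ₀ :- :1)
               :+ :- (a :+ k) :* (ρ₁ :+ :1) :+ ρ₁ :* (θ′ :+ k) :+ (k :- (c :+ a :+ b))) refl

      σ₂−σ₁≈0 : σ 2 − σ 1 ≈ 0#
      σ₂−σ₁≈0 = x*y≈0⇒x≈0 ρ₂+ρ₁≉0 (step 1 2≤D)
        where
        identity : ∀ a b ρ₁ ρ₂ →
                   a + a ≈ - 1# * (b * ρ₂ − (b + a + a)) + b * (ρ₂ + ρ₁) + - b * (ρ₁ + 1#)
        identity = solve 4 (λ a b ρ₁ ρ₂ →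
          a :+ a := :- :1 :* (b :* ρ₂ :- (b :+ a :+ a)) :+ b :* (ρ₂ :+ ρ₁) :+ :- b :* (ρ₁ :+ :1)) refl
        ρ₂+ρ₁≉0 : ¬ ρ 2 + ρ 1 ≈ 0#
        ρ₂+ρ₁≉0 ρ₂+ρ₁≈0 = fromℕ≉0 (≤-trans (aᵢ-pos 0 2≤D) (m≤m+n _ _))
          (trans (fromℕ-+ (I.aᵢ 1) (I.aᵢ 1))
                 (trans (identity (a 1) (b 1) (ρ 1) (ρ 2))
                        (- 1# ⊛ b₁ρ₂≈b₁+2a₁ ⊕ b 1 ⊛ ρ₂+ρ₁≈0 ⊕ - b 1 ⊛ ρ₁+1≈0)))

      c₁+kσ₁≈0 : c 1 + k * σ 1 ≈ 0#
      c₁+kσ₁≈0 = x*y≈0⇒y≈0 1−σ₁≉0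
        (trans (identity (c 1) (a 1) (b 1) k (σ 0) (σ 1) (σ 2) θ)
               (x≈y⇒x−y≈0 (recurrence σ-pcs 0 2≤D) ⊕ - c 1 ⊛ x≈y⇒x−y≈0 (σ₀≈1 σ-pcs)
                ⊕ - b 1 ⊛ σ₂−σ₁≈0 ⊕ - σ 1 ⊛ x≈y⇒x−y≈0 (k*σ₁≈θ σ-pcs 1≤D)
                ⊕ σ 1 ⊛ x≈y⇒x−y≈0 (k≈c+a+b 0 2≤D)))
        where
        1−σ₁≉0 : ¬ 1# − σ 1 ≈ 0#
        1−σ₁≉0 = θ≉k⇒σ₁≉1 σ-pcs 1≤D θ≉k ∘ sym ∘ x−y≈0⇒x≈y
        identity : ∀ c a b k σ₀ σ₁ σ₂ θ →
          (1# − σ₁) * (c + k * σ₁)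
            ≈ (c * σ₀ + a * σ₁ + b * σ₂ − θ * σ₁) + - c * (σ₀ − 1#) + - b * (σ₂ − σ₁)
              + - σ₁ * (k * σ₁ − θ) + σ₁ * (k − (c + a + b))
        identity = solve 8 (λ c a b k σ₀ σ₁ σ₂ θ →
          (:1 :- σ₁) :* (c :+ k :* σ₁)
            := (c :* σ₀ :+ a :* σ₁ :+ b :* σ₂ :- θ :* σ₁) :+ :- c :* (σ₀ :- :1)
               :+ :- b :* (σ₂ :- σ₁) :+ :- σ₁ :* (k :* σ₁ :- θ) :+ σ₁ :* (k :- (c :+ a :+ b))) refl

      σ₃−σ₂≉0 : ¬ σ 3 − σ 2 ≈ 0#
      σ₃−σ₂≉0 σ₃−σ₂≈0 =
        c≉0 0 1≤D (trans (identity₂ (c 1) k (σ 1)) (c₁+kσ₁≈0 ⊕ - k ⊛ σ₁≈0))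
        where
        identity₁ : ∀ c a b k σ₁ σ₂ σ₃ θ →
          σ₁ * (k − θ)
            ≈ (c * σ₁ + a * σ₂ + b * σ₃ − θ * σ₂) + (θ − a − b) * (σ₂ − σ₁) + - b * (σ₃ − σ₂)
              + σ₁ * (k − (c + a + b))
        identity₁ = solve 8 (λ c a b k σ₁ σ₂ σ₃ θ →
          σ₁ :* (k :- θ)
            := (c :* σ₁ :+ a :* σ₂ :+ b :* σ₃ :- θ :* σ₂) :+ (θ :- a :- b) :* (σ₂ :- σ₁)
               :+ :- b :* (σ₃ :- σ₂) :+ σ₁ :* (k :- (c :+ a :+ b))) refl
        σ₁≈0 : σ 1 ≈ 0#
        σ₁≈0 = x*y≈0⇒x≈0 (θ≉k ∘ sym ∘ x−y≈0⇒x≈y)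
          (trans (identity₁ (c 2) (a 2) (b 2) k (σ 1) (σ 2) (σ 3) θ)
                 (x≈y⇒x−y≈0 (recurrence σ-pcs 1 3≤D) ⊕ (θ − a 2 − b 2) ⊛ σ₂−σ₁≈0
                  ⊕ - b 2 ⊛ σ₃−σ₂≈0 ⊕ σ 1 ⊛ x≈y⇒x−y≈0 (k≈c+a+b 1 3≤D)))
        identity₂ : ∀ c k σ₁ → c ≈ (c + k * σ₁) + - k * σ₁
        identity₂ = solve 3 (λ c k σ₁ → c := (c :+ k :* σ₁) :+ :- k :* σ₁) refl

      ρ₃+ρ₂≉0 : ¬ ρ 3 + ρ 2 ≈ 0#
      ρ₃+ρ₂≉0 ρ₃+ρ₂≈0 =
        <⇒≢ (c*b<[a+a+c]*[b+a′+a′] b₁ c₂ (aᵢ-pos 0 2≤D) (aᵢ-pos 1 3≤D)) (fromℕ-injective (begin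
          fromℕ (c₂ ℕ.* b₁)                                    ≈⟨ fromℕ-* c₂ b₁ ⟩
          c 2 * b 1                                            ≈⟨ x−y≈0⇒x≈y product ⟨
          (a 2 + a 2 + c 2) * (b 1 + a 1 + a 1)                ≈⟨ *-cong (fromℕ-+₃ a₂ a₂ c₂)
                                                                         (fromℕ-+₃ b₁ a₁ a₁) ⟨
          fromℕ (a₂ ℕ.+ a₂ ℕ.+ c₂) * fromℕ (b₁ ℕ.+ a₁ ℕ.+ a₁)  ≈⟨ fromℕ-* (a₂ ℕ.+ a₂ ℕ.+ c₂)
                                                                          (b₁ ℕ.+ a₁ ℕ.+ a₁) ⟨
          fromℕ ((a₂ ℕ.+ a₂ ℕ.+ c₂) ℕ.* (b₁ ℕ.+ a₁ ℕ.+ a₁))    ∎))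
        where
        a₁ a₂ b₁ c₂ : ℕ
        a₁ = I.aᵢ 1
        a₂ = I.aᵢ 2
        b₁ = I.bᵢ 1
        c₂ = I.cᵢ 2
        identity₁ : ∀ c a b k ρ₁ ρ₂ ρ₃ θ′ →
          (a + a + c) * ρ₂ − c
            ≈ (c * ρ₁ + a * ρ₂ + b * ρ₃ − θ′ * ρ₂) + - c * (ρ₁ + 1#) + - b * (ρ₃ + ρ₂)
              + ρ₂ * (θ′ + k) + - ρ₂ * (k − (c + a + b))
        identity₁ = solve 8 (λ c a b k ρ₁ ρ₂ ρ₃ θ′ →
          (a :+ a :+ c) :* ρ₂ :- c
            := (c :* ρ₁ :+ a :* ρ₂ :+ b :* ρ₃ :- θ′ :* ρ₂) :+ :- c :* (ρ₁ :+ :1)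
               :+ :- b :* (ρ₃ :+ ρ₂) :+ ρ₂ :* (θ′ :+ k) :+ :- ρ₂ :* (k :- (c :+ a :+ b))) refl
        [2a₂+c₂]ρ₂≈c₂ : (a 2 + a 2 + c 2) * ρ 2 − c 2 ≈ 0#
        [2a₂+c₂]ρ₂≈c₂ = trans (identity₁ (c 2) (a 2) (b 2) k (ρ 1) (ρ 2) (ρ 3) θ′)
          (x≈y⇒x−y≈0 (recurrence ρ-pcs 1 3≤D) ⊕ - c 2 ⊛ ρ₁+1≈0 ⊕ - b 2 ⊛ ρ₃+ρ₂≈0
           ⊕ ρ 2 ⊛ θ′+k≈0 ⊕ - ρ 2 ⊛ x≈y⇒x−y≈0 (k≈c+a+b 1 3≤D))
        identity₂ : ∀ a₁ a₂ b₁ c₂ ρ₂ →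
          (a₂ + a₂ + c₂) * (b₁ + a₁ + a₁) − c₂ * b₁
            ≈ b₁ * ((a₂ + a₂ + c₂) * ρ₂ − c₂)
              + - (a₂ + a₂ + c₂) * (b₁ * ρ₂ − (b₁ + a₁ + a₁))
        identity₂ = solve 5 (λ a₁ a₂ b₁ c₂ ρ₂ →
          (a₂ :+ a₂ :+ c₂) :* (b₁ :+ a₁ :+ a₁) :- c₂ :* b₁
            := b₁ :* ((a₂ :+ a₂ :+ c₂) :* ρ₂ :- c₂)
               :+ :- (a₂ :+ a₂ :+ c₂) :* (b₁ :* ρ₂ :- (b₁ :+ a₁ :+ a₁))) refl
        product : (a 2 + a 2 + c 2) * (b 1 + a 1 + a 1) − c 2 * b 1 ≈ 0#
        product = trans (identity₂ (a 1) (a 2) (b 1) (c 2) (ρ 2))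
                        (b 1 ⊛ [2a₂+c₂]ρ₂≈c₂ ⊕ - (a 2 + a 2 + c 2) ⊛ b₁ρ₂≈b₁+2a₁)

      absurd : ⊥
      absurd = [ σ₃−σ₂≉0 , ρ₃+ρ₂≉0 ] (x*y≈0⇒x≈0⊎y≈0 (step 2 3≤D))

  ¬balanced-one : ∀ {σ ρ θ θ′} → IsPCSFor σ θ → IsPCSFor ρ θ′ → ¬ θ ≈ k → ¬ Balanced 1# σ ρ
  ¬balanced-one σ-pcs ρ-pcs θ≉k bal = BalancedAtOne.absurd σ-pcs ρ-pcs θ≉k bal

  1−ε²≉0 : ∀ {σ ρ θ θ′ ε} → IsPCSFor σ θ → IsPCSFor ρ θ′ → ¬ θ ≈ k → ¬ θ′ ≈ k →
           Balanced ε σ ρ → ¬ 1# − ε * ε ≈ 0#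
  1−ε²≉0 {ε = ε} σ-pcs ρ-pcs θ≉k θ′≉k bal 1−ε²≈0
    with x*y≈0⇒x≈0⊎y≈0 (trans ([1−x][1+x]≈1−x² ε) 1−ε²≈0)
  ... | inj₁ 1−ε≈0 = ¬balanced-one σ-pcs ρ-pcs θ≉k (balanced-cong (sym (x−y≈0⇒x≈y 1−ε≈0)) bal)
  ... | inj₂ 1+ε≈0 = ¬balanced-one ρ-pcs σ-pcs θ′≉k (balanced-cong -ε≈1 (balanced-swap bal))
    where
    -ε≈1 : - ε ≈ 1#
    -ε≈1 = trans (-‿cong (+-inverseʳ-unique 1# ε 1+ε≈0)) (-‿involutive 1#)

  -- The index i of the statement is suc j; (i)–(iv) name its four conditions.
  module AtIndex {σ ρ θ θ′ ε} (σ-pcs : IsPCSFor σ θ) (ρ-pcs : IsPCSFor ρ θ′)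
                 (θ≉k : ¬ θ ≈ k) (θ′≉k : ¬ θ′ ≈ k) (bal : Balanced ε σ ρ)
                 (j : ℕ) (2+j≤D : suc (suc j) ≤ D) where
    private
      1+j≤D : suc j ≤ D
      1+j≤D = ≤-trans (n≤1+n _) 2+j≤D
      x y z r s t : Carrier
      x = σ j
      y = σ (suc j)
      z = σ (suc (suc j))
      r = ρ j
      s = ρ (suc j)
      t = ρ (suc (suc j))
      cross₀ : Cross ε x y r s
      cross₀ = balanced⇒cross (bal j 1+j≤D)
      cross₁ : Cross ε z y t s
      cross₁ = cross-sym (balanced⇒cross (bal (suc j) 2+j≤D))
      ε²≉1 : ¬ 1# − ε * ε ≈ 0#
      ε²≉1 = 1−ε²≉0 σ-pcs ρ-pcs θ≉k θ′≉k bal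
      ≈ε*0 : ∀ {u v} → u ≈ ε * v → v ≈ 0# → u ≈ 0#
      ≈ε*0 u≈εv v≈0 = trans u≈εv (ε ⊛ v≈0)

    iv⇒i : s ≈ 0# → x ≈ ε * y
    iv⇒i s≈0 = cross-zero cross₀ s≈0 (λ r≈0 → no-adjacent-zeros ρ-pcs j 1+j≤D r≈0 s≈0)

    i⇒iv : x ≈ ε * y → s ≈ 0#
    i⇒iv x≈εy = cross-eigen cross₀ x≈εy y≉0 ε²≉1
      where
      y≉0 : ¬ y ≈ 0#
      y≉0 y≈0 = no-adjacent-zeros σ-pcs j 1+j≤D (≈ε*0 x≈εy y≈0) y≈0

    iv⇒ii : s ≈ 0# → z ≈ ε * y
    iv⇒ii s≈0 = cross-zero cross₁ s≈0 (no-adjacent-zeros ρ-pcs (suc j) 2+j≤D s≈0)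

    ii⇒iv : z ≈ ε * y → s ≈ 0#
    ii⇒iv z≈εy = cross-eigen cross₁ z≈εy y≉0 ε²≉1
      where
      y≉0 : ¬ y ≈ 0#
      y≉0 y≈0 = no-adjacent-zeros σ-pcs (suc j) 2+j≤D y≈0 (≈ε*0 z≈εy y≈0)

    iii⇒iv : x ≈ z → s ≈ 0#
    iii⇒iv x≈z with s ≟ 0# | x ≟ ε * y
    ... | yes s≈0 | _        = s≈0
    ... | no _    | yes x≈εy = i⇒iv x≈εy
    ... | no s≉0  | no x≉εy  = ⊥-elim $
      x≉0∧y≉0⇒x*y≉0 (a≉0 j 2+j≤D) (x≉0∧y≉0⇒x*y≉0 k−θ≉0 k−θ′≉0)
        (a*[k−θ]*[k−θ′]≈0 (k≈c+a+b j 2+j≤D) Q≈0 (eigenvalue-relation σ-pcs ρ-pcs bal))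
      where
      k−θ≉0 : ¬ k − θ ≈ 0#
      k−θ≉0 = θ≉k ∘ sym ∘ x−y≈0⇒x≈y
      k−θ′≉0 : ¬ k − θ′ ≈ 0#
      k−θ′≉0 = θ′≉k ∘ sym ∘ x−y≈0⇒x≈y
      identity : ∀ ε x y z r s t →
        (t − r) * (x − ε * y)
          ≈ ((y * s − x * r) − ε * (x * s − y * r)) + ((z * t − y * s) − ε * (y * t − z * s))
            + - (t + s * ε) * (z − x)
      identity = solve 7 (λ ε x y z r s t →
        (t :- r) :* (x :- ε :* y)
          := ((y :* s :- x :* r) :- ε :* (x :* s :- y :* r))
             :+ ((z :* t :- y :* s) :- ε :* (y :* t :- z :* s)) :+ :- (t :+ s :* ε) :* (z :- x)) refl
      t≈r : t ≈ r
      t≈r = x−y≈0⇒x≈y (x*y≈0⇒x≈0 (x≉εy ∘ x−y≈0⇒x≈y) (trans (identity ε x y z r s t)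
              (x≈y⇒x−y≈0 (bal j 1+j≤D) ⊕ x≈y⇒x−y≈0 (bal (suc j) 2+j≤D)
               ⊕ - (t + s * ε) ⊛ x≈y⇒x−y≈0 (sym x≈z))))
      m : Carrier
      m = b (suc j) + c (suc j)
      m≉0 : ¬ m ≈ 0#
      m≉0 m≈0 = fromℕ≉0 (≤-trans (cᵢ-pos j 1+j≤D) (m≤n+m (I.cᵢ (suc j)) (I.bᵢ (suc j))))
                        (trans (fromℕ-+ (I.bᵢ (suc j)) (I.cᵢ (suc j))) m≈0)
      mx≈[θ−a]y : m * x ≈ (θ − a (suc j)) * y
      mx≈[θ−a]y = symmetric-recurrence (recurrence σ-pcs j 2+j≤D) (sym x≈z)
      mr≈[θ′−a]s : m * r ≈ (θ′ − a (suc j)) * s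
      mr≈[θ′−a]s = symmetric-recurrence (recurrence ρ-pcs j 2+j≤D) t≈r
      y≉0 : ¬ y ≈ 0#
      y≉0 y≈0 =
        no-adjacent-zeros σ-pcs j 1+j≤D (x*y≈0⇒y≈0 m≉0 (trans mx≈[θ−a]y (_ ⊛ y≈0))) y≈0
      Q≈0 : m * m − ε * m * ((θ − a (suc j)) − (θ′ − a (suc j))) − (θ − a (suc j)) * (θ′ − a (suc j)) ≈ 0#
      Q≈0 = x*y≈0⇒y≈0 (x≉0∧y≉0⇒x*y≉0 s≉0 y≉0) (cross-quadratic mx≈[θ−a]y mr≈[θ′−a]s cross₀)

    equivalences : ((x ≈ ε * y) ⇔ (z ≈ ε * y)) × ((z ≈ ε * y) ⇔ (x ≈ z)) × ((x ≈ z) ⇔ (s ≈ 0#))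
    equivalences = mk⇔ (iv⇒ii ∘ i⇒iv) (iv⇒i ∘ ii⇒iv)
                 , mk⇔ (λ z≈εy → trans (iv⇒i (ii⇒iv z≈εy)) (sym z≈εy)) (iv⇒ii ∘ iii⇒iv)
                 , mk⇔ iii⇒iv (λ s≈0 → trans (iv⇒i s≈0) (sym (iv⇒ii s≈0)))

lemma11p1 : ∀ {c ℓ} (F : OrderedField c ℓ) (G : Graph) (D : ℕ) (p : ℕ → ℕ → ℕ → ℕ) →
    IsDistanceRegular G D p → 3 ≤ D → ¬ (Intersection.aᵢ p 1 ≡ 0) →
    (σ ρ : ℕ → OrderedField.Carrier F) → (ε : OrderedField.Carrier F) →
    PseudoCosine.IsPCS F D p σ → PseudoCosine.IsPCS F D p ρ →
    PseudoCosine.Nontrivial F D p σ → PseudoCosine.Nontrivial F D p ρ →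
    PseudoCosine.TightPair F D p σ ρ →
    (let open OrderedField F in
      ∀ i → suc i ≤ D →
        (σ (suc i) * ρ (suc i) − σ i * ρ i) ≈ ε * (σ i * ρ (suc i) − σ (suc i) * ρ i)) →
    (let open OrderedField F in
      ∀ i → 1 ≤ i → i ≤ D ∸ 1 →
        ((σ (i ∸ 1) ≈ ε * σ i) ⇔ (σ (suc i) ≈ ε * σ i))
        × ((σ (suc i) ≈ ε * σ i) ⇔ (σ (i ∸ 1) ≈ σ (suc i)))
        × ((σ (i ∸ 1) ≈ σ (suc i)) ⇔ (ρ i ≈ 0#)))
lemma11p1 F G D p drg 3≤D@(s≤s (s≤s (s≤s _))) a₁≢0 σ ρ ε (θ , σ-pcs) (θ′ , ρ-pcs)
          σ-nontrivial ρ-nontrivial _ bal (suc j) _ 1+j≤D∸1 =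
  AtIndex.equivalences σ-pcs ρ-pcs (nontrivial⇒θ≉k σ-pcs σ-nontrivial)
                       (nontrivial⇒θ≉k ρ-pcs ρ-nontrivial) bal j (s≤s 1+j≤D∸1)
  where
  facts : IntersectionFacts D p
  facts = DistanceRegularProperties.intersection-facts G drg (s≤s z≤n) a₁≢0
  open PseudoCosineProperties F facts using (nontrivial⇒θ≉k)
  open TightPairProperties F facts 3≤D using (module AtIndex)
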